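{- Let $m$ be a positive integer and $G$ a finite abelian group which is $m$-torsion (i.e. $mx=0$ for all $x\in G$). Let $A\subset G$ satisfy $\langle A-A\rangle=G$. Then for every integer $s\geq\Omega(|G|)$, $smA=G$.
   Context: For $n=p_1^{\alpha_1}\cdots p_k^{\alpha_k}$ (prime factorization), $\Omega(n)=\alpha_1+\cdots+\alpha_k$ (so $\Omega(1)=0$). For a positive integer $j$, $jA$ is the set of sums of $j$ not necessarily distinct elements of $A$, and $0A=\{0\}$. $A-A=\{a_1-a_2:a_1,a_2\in A\}$ and $\langle A-A\rangle$ is the subgroup it generates. -}

module Defs where

open import Level using (Level; _⊔_)
open import Data.Nat using (ℕ; zero; suc)
open import Data.Fin using (Fin)
open import Data.List using (length)
open import Data.Vec using (Vec; []; _∷_)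
open import Data.Vec.Relation.Unary.All using (All)
open import Data.Product using (Σ; ∃; _×_)
open import Relation.Binary.PropositionalEquality using (_≡_)
open import Algebra.Bundles using (AbelianGroup)
import Algebra.Definitions.RawMonoid as RM
open import Data.Nat.Primality.Factorisation using (factorise; factors)

-- Ω(n): number of prime factors of n counted with multiplicity,
-- i.e. the length of the prime factorisation of n.  Ω(1) = 0.
-- (Ω 0 is irrelevant here and set to 0.)
Ω : ℕ → ℕ
Ω zero = 0
Ω (suc k) = length (factors (factorise (suc k)))

module _ {c ℓ : Level} (G : AbelianGroup c ℓ) where
  open AbelianGroup G

  _·_ : ℕ → Carrier → Carrier
  _·_ = RM._×_ rawMonoid

  IsTorsion : ℕ → Set (c ⊔ ℓ)
  IsTorsion m = ∀ x → (m · x) ≈ ε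

  record HasOrder (n : ℕ) : Set (c ⊔ ℓ) where
    field
      enum  : Fin n → Carrier
      surj  : ∀ x → ∃ λ i → enum i ≈ x
      inj   : ∀ i j → enum i ≈ enum j → i ≡ j

  vsum : ∀ {j} → Vec Carrier j → Carrier
  vsum [] = ε
  vsum (x ∷ v) = x ∙ vsum v

  -- x ∈ jA : x is a sum of j (not necessarily distinct) elements of A; 0A = {0}
  InSumset : ∀ {a} → ℕ → (Carrier → Set a) → Carrier → Set (c ⊔ ℓ ⊔ a)
  InSumset j A x = Σ (Vec Carrier j) λ v → All A v × (vsum v ≈ x)

  InDiff : ∀ {a} → (Carrier → Set a) → Carrier → Set (c ⊔ ℓ ⊔ a)
  InDiff A x = Σ Carrier λ a₁ → Σ Carrier λ a₂ → A a₁ × A a₂ × (x ≈ (a₁ ∙ (a₂ ⁻¹)))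

  data InGen {a} (S : Carrier → Set a) : Carrier → Set (c ⊔ ℓ ⊔ a) where
    gen-base : ∀ {x} → S x → InGen S x
    gen-zero : InGen S ε
    gen-add  : ∀ {x y} → InGen S x → InGen S y → InGen S (x ∙ y)
    gen-neg  : ∀ {x} → InGen S x → InGen S (x ⁻¹)
    gen-resp : ∀ {x y} → x ≈ y → InGen S x → InGen S y

-- Fix a₀ ∈ A and build a tower {0} = H₀ < H₁ < ⋯ < H_k by adjoining elements
-- b = x - a₀ (x ∈ A).  If t ≥ 2 is least with t b ∈ H, then the t·|H| sums
-- h + j b (h ∈ H, j < t) are distinct and form H + ⟨b⟩; torsion gives t ≤ m,
-- and j b = j x + (m - j) a₀ ∈ mA, so inductively H_k ⊆ kmA.  As the b's
-- generate ⟨A - A⟩ = G we can reach H_k = G; then |G| = t₁ ⋯ t_k with all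
-- tᵢ ≥ 2 gives k ≤ Ω(|G|) ≤ s, and padding with (s - k)m copies of a₀
-- (summing to 0) yields G ⊆ smA.
module Submission where

open import Defs
open import Level using (Level; _⊔_)
open import Function using (_∘_)
open import Function.Definitions using (Injective)
open import Data.Empty using (⊥-elim)
open import Data.Sum using (inj₁; inj₂)
open import Data.Product using (Σ; ∃; _×_; _,_; proj₁; proj₂; uncurry)
open import Data.Nat using (ℕ; zero; suc; pred; _+_; _*_; _∸_; _≤_; _<_; z≤n; s≤s; NonZero; >-nonZero; _<?_)
open import Data.Nat.Properties
open import Data.Nat.ListAction using (product)
open import Data.Nat.ListAction.Properties using (product-++)
open import Data.Nat.Primality using (productOfPrimes≥1)
open import Data.Nat.Primality.Factorisation
  using (PrimeFactorisation; factorise; factors; factorisationUnique; primeFactorisation[1])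
open import Data.List using (List; []; _∷_; _++_; length)
open import Data.List.Properties using (length-++)
open import Data.List.Relation.Unary.All using (All; []; _∷_)
import Data.List.Relation.Unary.All.Properties as ListAll
open import Data.List.Relation.Binary.Permutation.Propositional.Properties using (↭-length)
open import Data.Fin using (Fin; toℕ; fromℕ<; combine; remQuot)
import Data.Fin as Fin
open import Data.Fin.Properties
  using (any?; remQuot-combine; combine-remQuot; toℕ-fromℕ<; toℕ-injective; toℕ<n; cantor-schröder-bernstein)
  renaming (_≟_ to _≟ᶠ_)
import Data.Vec as Vec
import Data.Vec.Relation.Unary.All as VecAll
import Data.Vec.Relation.Unary.All.Properties as VecAll
open import Relation.Nullary using (¬_; yes; no; contradiction)
open import Relation.Unary using (Decidable)
import Relation.Binary as B
import Relation.Binary.PropositionalEquality as ≡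
open ≡ using (_≡_)
open import Algebra.Bundles using (AbelianGroup)

open PrimeFactorisation using (isFactorisation; factorsPrime)

-- By uniqueness of factorisation, Ω n is the length of ANY prime
-- factorisation of n.
Ω-factorisation : ∀ {n} (f : PrimeFactorisation n) → Ω n ≡ length (factors f)
Ω-factorisation {zero} f =
  contradiction (≡.subst (1 ≤_) (≡.sym (isFactorisation f)) (productOfPrimes≥1 (factorsPrime f))) λ ()
Ω-factorisation {suc k} f = ↭-length (factorisationUnique (factorise (suc k)) f)

_⊗_ : ∀ {a b} → PrimeFactorisation a → PrimeFactorisation b → PrimeFactorisation (a * b)
f ⊗ g = record
  { factors = factors f ++ factors g
  ; isFactorisation = ≡.trans (≡.cong₂ _*_ (isFactorisation f) (isFactorisation g))
                            (≡.sym (product-++ (factors f) (factors g)))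
  ; factorsPrime = ListAll.++⁺ (factorsPrime f) (factorsPrime g)
  }

factors-nonempty : ∀ {t} → 2 ≤ t → (f : PrimeFactorisation t) → 1 ≤ length (factors f)
factors-nonempty 2≤t record { factors = [] ; isFactorisation = t≡1 } =
  contradiction (≡.subst (2 ≤_) t≡1 2≤t) λ { (s≤s ()) }
factors-nonempty _ record { factors = _ ∷ _ } = s≤s z≤n

factorisation-of-product : ∀ ts → All (2 ≤_) ts →
  Σ (PrimeFactorisation (product ts)) λ f → length ts ≤ length (factors f)
factorisation-of-product [] [] = primeFactorisation[1] , z≤n
factorisation-of-product (t ∷ ts) (2≤t ∷ ts≥2) with factorisation-of-product ts ts≥2
... | f , len≤ = fₜ ⊗ f , (begin
    suc (length ts)                          ≤⟨ +-mono-≤ (factors-nonempty 2≤t fₜ) len≤ ⟩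
    length (factors fₜ) + length (factors f) ≡⟨ ≡.sym (length-++ (factors fₜ)) ⟩
    length (factors fₜ ++ factors f)         ∎)
  where
  open ≤-Reasoning
  fₜ : PrimeFactorisation t
  fₜ = factorise t {{>-nonZero (≤-trans (s≤s z≤n) 2≤t)}}

length≤Ω-product : ∀ ts → All (2 ≤_) ts → length ts ≤ Ω (product ts)
length≤Ω-product ts ts≥2 with factorisation-of-product ts ts≥2
... | f , len≤ = ≤-trans len≤ (≤-reflexive (≡.sym (Ω-factorisation f)))

least : ∀ {p} {P : ℕ → Set p} → Decidable P → ∀ {n} → P n →
  ∃ λ t → t ≤ n × P t × (∀ j → j < t → ¬ P j)
least P? {zero} P0 = 0 , z≤n , P0 , λ _ ()
least {P = P} P? {suc n} Pn with P? 0
... | yes P0 = 0 , z≤n , P0 , λ _ ()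
... | no ¬P0 with least {P = P ∘ suc} (λ j → P? (suc j)) {n} Pn
...   | t , t≤n , Pt , below =
  suc t , s≤s t≤n , Pt , λ { zero _ → ¬P0 ; (suc j) (s≤s j<t) → below j j<t }

module GroupTheory {c ℓ : Level} (G : AbelianGroup c ℓ) where
  open AbelianGroup G
  open import Algebra.Properties.AbelianGroup G using (∙-cancelʳ; \\-leftDividesʳ; ⁻¹-anti-homo‿-; inverseʳ-unique)
  open import Algebra.Properties.CommutativeSemigroup commutativeSemigroup using (interchange)
  open import Algebra.Properties.CommutativeMonoid.Mult commutativeMonoid
    using (×-homo-+; ×-distrib-+; ×-assocˡ; ×-congʳ; ×-congˡ)
    renaming (_×_ to infixr 8 _⋆_)
  open import Relation.Binary.Reasoning.Setoid setoid

  -- Multiples j ⋆ x are the same operation as `_·_ G` from Defs; j 0 = 0.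
  ⋆-ε : ∀ j → j ⋆ ε ≈ ε
  ⋆-ε zero = refl
  ⋆-ε (suc j) = trans (identityˡ _) (⋆-ε j)

  finite⇒≈-dec : ∀ {n} → HasOrder G n → B.Decidable _≈_
  finite⇒≈-dec ho x y with HasOrder.surj ho x | HasOrder.surj ho y
  ... | i , eᵢ≈x | j , eⱼ≈y with i ≟ᶠ j
  ...   | yes ≡.refl = yes (trans (sym eᵢ≈x) eⱼ≈y)
  ...   | no i≢j = no λ x≈y → i≢j (HasOrder.inj ho i j (trans eᵢ≈x (trans x≈y (sym eⱼ≈y))))

  _∈ᵉ_ : ∀ {N} → Carrier → (Fin N → Carrier) → Set ℓ
  x ∈ᵉ e = ∃ λ i → e i ≈ x

  ∈ᵉ-resp : ∀ {N} {e : Fin N → Carrier} {x y} → x ≈ y → x ∈ᵉ e → y ∈ᵉ e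
  ∈ᵉ-resp x≈y (i , eᵢ≈x) = i , trans eᵢ≈x x≈y

  index-injective : ∀ {N M} (e : Fin N → Carrier) → (∀ i j → e i ≈ e j → i ≡ j) →
    (e′ : Fin M → Carrier) (cover : ∀ i → e i ∈ᵉ e′) → Injective _≡_ _≡_ (proj₁ ∘ cover)
  index-injective e e-inj e′ cover {i} {j} same =
    e-inj i j (trans (sym (proj₂ (cover i))) (trans (reflexive (≡.cong e′ same)) (proj₂ (cover j))))

  record FinSubmonoid (N : ℕ) : Set (c ⊔ ℓ) where
    field
      elem : Fin N → Carrier
      elem-injective : ∀ i j → elem i ≈ elem j → i ≡ j
      ∙-closed : ∀ i j → (elem i ∙ elem j) ∈ᵉ elem
      ε-mem : ε ∈ᵉ elem

  _∈_ : ∀ {N} → Carrier → FinSubmonoid N → Set ℓ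
  x ∈ H = x ∈ᵉ FinSubmonoid.elem H

  module _ {N} (H : FinSubmonoid N) where
    open FinSubmonoid H

    ∈-∙ : ∀ {x y} → x ∈ H → y ∈ H → (x ∙ y) ∈ H
    ∈-∙ (i , eᵢ≈x) (j , eⱼ≈y) = ∈ᵉ-resp (∙-cong eᵢ≈x eⱼ≈y) (∙-closed i j)

    ∈-⋆ : ∀ j {x} → x ∈ H → (j ⋆ x) ∈ H
    ∈-⋆ zero _ = ε-mem
    ∈-⋆ (suc j) x∈H = ∈-∙ x∈H (∈-⋆ j x∈H)

    ∈-dec : B.Decidable _≈_ → Decidable (_∈ H)
    ∈-dec _≈?_ x = any? (λ i → elem i ≈? x)

    size-of-total : ∀ {n} → HasOrder G n → (∀ y → y ∈ H) → N ≡ n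
    size-of-total ho total = cantor-schröder-bernstein
      (index-injective elem elem-injective enum (surj ∘ elem))
      (index-injective enum inj elem (total ∘ enum))
      where open HasOrder ho

  trivial : FinSubmonoid 1
  trivial = record
    { elem = λ _ → ε
    ; elem-injective = λ { Fin.zero Fin.zero _ → ≡.refl }
    ; ∙-closed = λ _ _ → Fin.zero , sym (identityˡ ε)
    ; ε-mem = Fin.zero , refl
    }

  -- Adjoining b to a finite subgroup H, where t = suc k is the least positive
  -- integer with t b ∈ H: the elements h + j b (h ∈ H, j < t) are pairwise
  -- distinct and form a submonoid H⁺ with t · |H| elements.
  module Adjoin {N} (H : FinSubmonoid N) (∈-⁻¹ : ∀ {x} → x ∈ H → (x ⁻¹) ∈ H)
                (b : Carrier) (k : ℕ) (tb∈H : (suc k ⋆ b) ∈ H)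
                (minimal : ∀ j → j < k → ¬ ((suc j ⋆ b) ∈ H)) where
    open FinSubmonoid H

    t : ℕ
    t = suc k

    shifted : Fin t → Fin N → Carrier
    shifted f i = elem i ∙ toℕ f ⋆ b

    -- z ↦ (multiplier z , position z) is the bijection Fin (t * N) ≅ Fin t × Fin N.
    multiplier : Fin (t * N) → Fin t
    multiplier z = proj₁ (remQuot {t} N z)

    position : Fin (t * N) → Fin N
    position z = proj₂ (remQuot {t} N z)

    elem⁺ : Fin (t * N) → Carrier
    elem⁺ z = shifted (multiplier z) (position z)

    -- h + j b is enumerated for h ∈ H and j < t ...
    shift-mem : ∀ {h} j → j < t → h ∈ H → (h ∙ j ⋆ b) ∈ᵉ elem⁺
    shift-mem {h} j j<t (i , eᵢ≈h) = combine f i , (begin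
      elem⁺ (combine f i)  ≡⟨ ≡.cong (uncurry shifted) (remQuot-combine f i) ⟩
      elem i ∙ toℕ f ⋆ b   ≈⟨ ∙-cong eᵢ≈h (×-congˡ (toℕ-fromℕ< j<t)) ⟩
      h ∙ j ⋆ b            ∎)
      where
      f : Fin t
      f = fromℕ< j<t

    -- ... and also for j < 2t, since h + (t + r) b = (h + t b) + r b.
    shift-mem₂ : ∀ {h} j → j < t + t → h ∈ H → (h ∙ j ⋆ b) ∈ᵉ elem⁺
    shift-mem₂ {h} j j<2t h∈H with j <? t
    ... | yes j<t = shift-mem j j<t h∈H
    ... | no j≮t = ∈ᵉ-resp regroup (shift-mem r r<t (∈-∙ H h∈H tb∈H))
      where
      r : ℕ
      r = j ∸ t
      t+r≡j : t + r ≡ j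
      t+r≡j = m+[n∸m]≡n (≮⇒≥ j≮t)
      r<t : r < t
      r<t = +-cancelˡ-< t r t (≡.subst (_< t + t) (≡.sym t+r≡j) j<2t)
      regroup : (h ∙ t ⋆ b) ∙ r ⋆ b ≈ h ∙ j ⋆ b
      regroup = trans (assoc h _ _) (∙-congˡ (trans (sym (×-homo-+ b t r)) (×-congˡ t+r≡j)))

    ∙-closed⁺ : ∀ z z′ → (elem⁺ z ∙ elem⁺ z′) ∈ᵉ elem⁺
    ∙-closed⁺ z z′ = ∈ᵉ-resp (sym regroup)
      (shift-mem₂ (toℕ f + toℕ f′) (+-mono-< (toℕ<n f) (toℕ<n f′)) (∙-closed i i′))
      where
      f f′ : Fin t
      f = multiplier z
      f′ = multiplier z′
      i i′ : Fin N
      i = position z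
      i′ = position z′
      regroup : shifted f i ∙ shifted f′ i′ ≈ (elem i ∙ elem i′) ∙ (toℕ f + toℕ f′) ⋆ b
      regroup = trans (interchange _ _ _ _) (∙-congˡ (sym (×-homo-+ b (toℕ f) (toℕ f′))))

    cancel-shift : ∀ {h h′} j d → h ∙ j ⋆ b ≈ h′ ∙ (d + j) ⋆ b → h ≈ h′ ∙ d ⋆ b
    cancel-shift {h} {h′} j d same = ∙-cancelʳ (j ⋆ b) h (h′ ∙ d ⋆ b)
      (trans same (trans (∙-congˡ (×-homo-+ b d j)) (sym (assoc _ _ _))))

    -- Minimality of t: h + j b = h′ + (d + j) b with d + j < t forces d = 0
    -- and h = h′, because then d b = h - h′ ∈ H.
    no-collision : ∀ {h h′} j d → d + j < t → h ∈ H → h′ ∈ H →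
      h ∙ j ⋆ b ≈ h′ ∙ (d + j) ⋆ b → d ≡ 0 × h ≈ h′
    no-collision j zero _ _ _ same = ≡.refl , trans (cancel-shift j 0 same) (identityʳ _)
    no-collision {h} {h′} j (suc d) (s≤s d+j<k) h∈H h′∈H same =
      ⊥-elim (minimal d (≤-<-trans (m≤m+n d j) d+j<k) db∈H)
      where
      db∈H : (suc d ⋆ b) ∈ H
      db∈H = ∈ᵉ-resp (trans (∙-congˡ (cancel-shift j (suc d) same)) (\\-leftDividesʳ h′ _))
               (∈-∙ H (∈-⁻¹ h′∈H) h∈H)

    ordered-injective : ∀ f i f′ i′ → toℕ f ≤ toℕ f′ → shifted f i ≈ shifted f′ i′ → f ≡ f′ × i ≡ i′
    ordered-injective f i f′ i′ f≤f′ same = f≡f′ , elem-injective i i′ (proj₂ collision)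
      where
      d : ℕ
      d = toℕ f′ ∸ toℕ f
      d+f≡f′ : d + toℕ f ≡ toℕ f′
      d+f≡f′ = m∸n+n≡m f≤f′
      collision : d ≡ 0 × elem i ≈ elem i′
      collision = no-collision (toℕ f) d (≡.subst (_< t) (≡.sym d+f≡f′) (toℕ<n f′))
        (i , refl) (i′ , refl) (trans same (∙-congˡ (×-congˡ (≡.sym d+f≡f′))))
      f≡f′ : f ≡ f′
      f≡f′ = toℕ-injective (≡.trans (≡.sym (≡.cong (_+ toℕ f) (proj₁ collision))) d+f≡f′)

    shifted-injective : ∀ f i f′ i′ → shifted f i ≈ shifted f′ i′ → f ≡ f′ × i ≡ i′
    shifted-injective f i f′ i′ same with ≤-total (toℕ f) (toℕ f′)
    ... | inj₁ f≤f′ = ordered-injective f i f′ i′ f≤f′ same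
    ... | inj₂ f′≤f with ordered-injective f′ i′ f i f′≤f (sym same)
    ...   | f′≡f , i′≡i = ≡.sym f′≡f , ≡.sym i′≡i

    elem⁺-injective : ∀ z z′ → elem⁺ z ≈ elem⁺ z′ → z ≡ z′
    elem⁺-injective z z′ same
      with shifted-injective (multiplier z) (position z) (multiplier z′) (position z′) same
    ... | f≡f′ , i≡i′ = ≡.trans (≡.sym (combine-remQuot {t} N z))
                          (≡.trans (≡.cong₂ combine f≡f′ i≡i′) (combine-remQuot {t} N z′))

    H⁺ : FinSubmonoid (t * N)
    H⁺ = record
      { elem = elem⁺
      ; elem-injective = elem⁺-injective
      ; ∙-closed = ∙-closed⁺
      ; ε-mem = ∈ᵉ-resp (identityʳ ε) (shift-mem 0 (s≤s z≤n) ε-mem)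
      }

    H⊆H⁺ : ∀ {x} → x ∈ H → x ∈ H⁺
    H⊆H⁺ x∈H = ∈ᵉ-resp (identityʳ _) (shift-mem 0 (s≤s z≤n) x∈H)

    b∈H⁺ : 0 < k → b ∈ H⁺
    b∈H⁺ 0<k = ∈ᵉ-resp (trans (identityˡ _) (identityʳ b)) (shift-mem 1 (s≤s 0<k) ε-mem)

  module Sumsets {a} (A : Carrier → Set a) where

    Sum : ℕ → Carrier → Set (c ⊔ ℓ ⊔ a)
    Sum j = InSumset G j A

    sum-ε : Sum 0 ε
    sum-ε = Vec.[] , VecAll.[] , refl

    vsum-++ : ∀ {p q} (v : Vec.Vec Carrier p) (w : Vec.Vec Carrier q) →
      vsum G (v Vec.++ w) ≈ vsum G v ∙ vsum G w
    vsum-++ Vec.[] w = sym (identityˡ _)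
    vsum-++ (x Vec.∷ v) w = trans (∙-congˡ (vsum-++ v w)) (sym (assoc _ _ _))

    sum-∙ : ∀ {p q x y} → Sum p x → Sum q y → Sum (p + q) (x ∙ y)
    sum-∙ (v , v⊆A , Σv≈x) (w , w⊆A , Σw≈y) =
      v Vec.++ w , VecAll.++⁺ v⊆A w⊆A , trans (vsum-++ v w) (∙-cong Σv≈x Σw≈y)

    sum-resp : ∀ {p x y} → x ≈ y → Sum p x → Sum p y
    sum-resp x≈y (v , v⊆A , Σv≈x) = v , v⊆A , trans Σv≈x x≈y

    sum-⋆ : ∀ {x} → A x → ∀ j → Sum j (j ⋆ x)
    sum-⋆ x∈A zero = sum-ε
    sum-⋆ x∈A (suc j) with sum-⋆ x∈A j
    ... | v , v⊆A , Σv≈jx = _ Vec.∷ v , x∈A VecAll.∷ v⊆A , ∙-congˡ Σv≈jx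

  module Construction (m : ℕ) (m≢0 : NonZero m) (tor : IsTorsion G m)
                      {n : ℕ} (ho : HasOrder G n)
                      {a} (A : Carrier → Set a) (a₀ : Carrier) (a₀∈A : A a₀) where
    open Sumsets A

    pred-m+1≡m : suc (pred m) ≡ m
    pred-m+1≡m = suc-pred m {{m≢0}}

    -- In an m-torsion group -x = (m - 1) x, so every finite submonoid is a
    -- subgroup.
    ⁻¹-as-multiple : ∀ x → x ⁻¹ ≈ pred m ⋆ x
    ⁻¹-as-multiple x = sym (inverseʳ-unique x (pred m ⋆ x) (trans (×-congˡ pred-m+1≡m) (tor x)))

    ∈-⁻¹ : ∀ {N} (H : FinSubmonoid N) {x} → x ∈ H → (x ⁻¹) ∈ H
    ∈-⁻¹ H x∈H = ∈ᵉ-resp (sym (⁻¹-as-multiple _)) (∈-⋆ H (pred m) x∈H)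

    -- For x ∈ A and j ≤ m: j (x - a₀) = j x + (m - j) a₀ ∈ mA.
    multiple-of-difference : ∀ {x} → A x → ∀ {j} → j ≤ m → Sum m (j ⋆ (x ∙ a₀ ⁻¹))
    multiple-of-difference {x} x∈A {j} j≤m =
      ≡.subst (λ i → Sum i _) (m+[n∸m]≡n j≤m)
        (sum-resp (trans (∙-congˡ complement) (sym (×-distrib-+ x (a₀ ⁻¹) j)))
          (sum-∙ (sum-⋆ x∈A j) (sum-⋆ a₀∈A (m ∸ j))))
      where
      complement : (m ∸ j) ⋆ a₀ ≈ j ⋆ (a₀ ⁻¹)
      complement = ∙-cancelʳ (j ⋆ a₀) _ _ (begin
        (m ∸ j) ⋆ a₀ ∙ j ⋆ a₀   ≈⟨ sym (×-homo-+ a₀ (m ∸ j) j) ⟩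
        (m ∸ j + j) ⋆ a₀        ≈⟨ ×-congˡ (m∸n+n≡m j≤m) ⟩
        m ⋆ a₀                  ≈⟨ tor a₀ ⟩
        ε                       ≈⟨ sym (⋆-ε j) ⟩
        j ⋆ ε                   ≈⟨ ×-congʳ j (sym (inverseˡ a₀)) ⟩
        j ⋆ (a₀ ⁻¹ ∙ a₀)        ≈⟨ ×-distrib-+ (a₀ ⁻¹) a₀ j ⟩
        j ⋆ (a₀ ⁻¹) ∙ j ⋆ a₀    ∎)

    -- Padding: (s - k) m copies of a₀ sum to 0, so kmA ⊆ smA for k ≤ s.
    pad : ∀ {k s y} → k ≤ s → Sum (k * m) y → Sum (s * m) y
    pad {k} {s} {y} k≤s y∈kmA =
      ≡.subst (λ i → Sum i y)
        (≡.trans (≡.sym (*-distribʳ-+ m k (s ∸ k))) (≡.cong (_* m) (m+[n∸m]≡n k≤s)))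
        (sum-resp (trans (∙-congˡ vanishes) (identityʳ y))
          (sum-∙ y∈kmA (sum-⋆ a₀∈A ((s ∸ k) * m))))
      where
      vanishes : ((s ∸ k) * m) ⋆ a₀ ≈ ε
      vanishes = trans (sym (×-assocˡ a₀ (s ∸ k) m)) (trans (×-congʳ (s ∸ k) (tor a₀)) (⋆-ε (s ∸ k)))

    record Tower : Set (c ⊔ ℓ ⊔ a) where
      field
        indices : List ℕ
        indices≥2 : All (2 ≤_) indices
        subgroup : FinSubmonoid (product indices)
        covered : ∀ i → Sum (length indices * m) (FinSubmonoid.elem subgroup i)

    open Tower

    _∈ᵀ_ : Carrier → Tower → Set ℓ
    x ∈ᵀ T = x ∈ subgroup T

    _⊑_ : Tower → Tower → Set (c ⊔ ℓ)
    T ⊑ T′ = ∀ {x} → x ∈ᵀ T → x ∈ᵀ T′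

    ⊑-trans : ∀ {T₁ T₂ T₃} → T₁ ⊑ T₂ → T₂ ⊑ T₃ → T₁ ⊑ T₃
    ⊑-trans T₁⊑T₂ T₂⊑T₃ x∈T₁ = T₂⊑T₃ (T₁⊑T₂ x∈T₁)

    base : Tower
    base = record { indices = [] ; indices≥2 = [] ; subgroup = trivial ; covered = λ _ → sum-ε }

    -- A tower can be enlarged to contain x - a₀ for any x ∈ A: adjoin it
    -- with t the least positive integer putting t (x - a₀) in the subgroup
    -- (t ≤ m by torsion); nothing changes when t = 1.
    extend : (T : Tower) → ∀ {x} → A x → Σ Tower λ T′ → T ⊑ T′ × (x ∙ a₀ ⁻¹) ∈ᵀ T′
    extend T {x} x∈A = grow (least (λ j → ∈-dec H (finite⇒≈-dec ho) (suc j ⋆ b)) mb∈H)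
      where
      H : FinSubmonoid (product (indices T))
      H = subgroup T
      b : Carrier
      b = x ∙ a₀ ⁻¹

      mb∈H : (suc (pred m) ⋆ b) ∈ H
      mb∈H = ∈ᵉ-resp (sym (trans (×-congˡ pred-m+1≡m) (tor b))) (FinSubmonoid.ε-mem H)

      grow : (∃ λ k → k ≤ pred m × (suc k ⋆ b) ∈ H × (∀ j → j < k → ¬ ((suc j ⋆ b) ∈ H))) →
             Σ Tower λ T′ → T ⊑ T′ × b ∈ᵀ T′
      grow (zero , _ , b∈H , _) = T , (λ x∈T → x∈T) , ∈ᵉ-resp (identityʳ b) b∈H
      grow (k@(suc _) , k≤m-1 , tb∈H , minimal) = T′ , H⊆H⁺ , b∈H⁺ (s≤s z≤n)
        where
        open Adjoin H (∈-⁻¹ H) b k tb∈H minimal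
        t≤m : t ≤ m
        t≤m = ≡.subst (t ≤_) pred-m+1≡m (s≤s k≤m-1)
        covered⁺ : ∀ z → Sum (suc (length (indices T)) * m) (elem⁺ z)
        covered⁺ z = sum-resp (comm _ _)
          (sum-∙ (multiple-of-difference x∈A (≤-trans (<⇒≤ (toℕ<n (multiplier z))) t≤m))
                 (covered T (position z)))
        T′ : Tower
        T′ = record
          { indices = t ∷ indices T
          ; indices≥2 = s≤s (s≤s z≤n) ∷ indices≥2 T
          ; subgroup = H⁺
          ; covered = covered⁺
          }

    difference-via-base : ∀ a₁ a₂ → (a₁ ∙ a₀ ⁻¹) ∙ (a₂ ∙ a₀ ⁻¹) ⁻¹ ≈ a₁ ∙ a₂ ⁻¹
    difference-via-base a₁ a₂ = begin
      (a₁ ∙ a₀ ⁻¹) ∙ (a₂ ∙ a₀ ⁻¹) ⁻¹ ≈⟨ ∙-congˡ (⁻¹-anti-homo‿- a₂ a₀) ⟩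
      (a₁ ∙ a₀ ⁻¹) ∙ (a₀ ∙ a₂ ⁻¹)    ≈⟨ assoc _ _ _ ⟩
      a₁ ∙ (a₀ ⁻¹ ∙ (a₀ ∙ a₂ ⁻¹))    ≈⟨ ∙-congˡ (\\-leftDividesʳ a₀ _) ⟩
      a₁ ∙ a₂ ⁻¹                     ∎

    absorb : ∀ {y} → InGen G (InDiff G A) y → (T : Tower) → Σ Tower λ T′ → T ⊑ T′ × y ∈ᵀ T′
    absorb (gen-base (a₁ , a₂ , a₁∈A , a₂∈A , y≈a₁-a₂)) T
      with extend T a₁∈A
    ... | T₁ , T⊑T₁ , b₁∈T₁ with extend T₁ a₂∈A
    ...   | T₂ , T₁⊑T₂ , b₂∈T₂ = T₂ , ⊑-trans {T} {T₁} {T₂} T⊑T₁ T₁⊑T₂ ,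
      ∈ᵉ-resp (trans (difference-via-base a₁ a₂) (sym y≈a₁-a₂))
        (∈-∙ (subgroup T₂) (T₁⊑T₂ b₁∈T₁) (∈-⁻¹ (subgroup T₂) b₂∈T₂))
    absorb gen-zero T = T , (λ x∈T → x∈T) , FinSubmonoid.ε-mem (subgroup T)
    absorb (gen-add gx gy) T with absorb gx T
    ... | T₁ , T⊑T₁ , x∈T₁ with absorb gy T₁
    ...   | T₂ , T₁⊑T₂ , y∈T₂ =
      T₂ , ⊑-trans {T} {T₁} {T₂} T⊑T₁ T₁⊑T₂ , ∈-∙ (subgroup T₂) (T₁⊑T₂ x∈T₁) y∈T₂
    absorb (gen-neg gx) T with absorb gx T
    ... | T₁ , T⊑T₁ , x∈T₁ = T₁ , T⊑T₁ , ∈-⁻¹ (subgroup T₁) x∈T₁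
    absorb (gen-resp x≈y gx) T with absorb gx T
    ... | T₁ , T⊑T₁ , x∈T₁ = T₁ , T⊑T₁ , ∈ᵉ-resp x≈y x∈T₁

    absorb-all : (∀ y → InGen G (InDiff G A) y) →
      ∀ {k} (e : Fin k → Carrier) (T : Tower) → Σ Tower λ T′ → T ⊑ T′ × (∀ i → e i ∈ᵀ T′)
    absorb-all gen {zero} e T = T , (λ x∈T → x∈T) , λ ()
    absorb-all gen {suc k} e T with absorb (gen (e Fin.zero)) T
    ... | T₁ , T⊑T₁ , e₀∈T₁ with absorb-all gen (e ∘ Fin.suc) T₁
    ...   | T₂ , T₁⊑T₂ , rest∈T₂ = T₂ , ⊑-trans {T} {T₁} {T₂} T⊑T₁ T₁⊑T₂ , λ
      { Fin.zero → T₁⊑T₂ e₀∈T₁ ; (Fin.suc i) → rest∈T₂ i }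

    complete-tower : (∀ y → InGen G (InDiff G A) y) → Σ Tower λ T → ∀ y → y ∈ᵀ T
    complete-tower gen with absorb-all gen (HasOrder.enum ho) base
    ... | T , _ , enum∈T = T , λ y → let (i , eᵢ≈y) = HasOrder.surj ho y in ∈ᵉ-resp eᵢ≈y (enum∈T i)

    height≤Ω : (T : Tower) → (∀ y → y ∈ᵀ T) → length (indices T) ≤ Ω n
    height≤Ω T total = ≤-trans (length≤Ω-product (indices T) (indices≥2 T))
      (≤-reflexive (≡.cong Ω (size-of-total (subgroup T) ho total)))

lemma5p1 : {c ℓ a : Level} (G : AbelianGroup c ℓ) (m : ℕ) → NonZero m →
    (n : ℕ) → HasOrder G n → IsTorsion G m →
    (A : AbelianGroup.Carrier G → Set a) → ∃ A →
    (∀ x → InGen G (InDiff G A) x) →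
    (s : ℕ) → Ω n ≤ s → ∀ x → InSumset G (s * m) A x
lemma5p1 G m m≢0 n ho tor A (a₀ , a₀∈A) gen s Ωn≤s y =
  let open GroupTheory G
      open Construction m m≢0 tor ho A a₀ a₀∈A
      (T , total) = complete-tower gen
      (i , eᵢ≈y) = total y
  in pad (≤-trans (height≤Ω T total) Ωn≤s) (Sumsets.sum-resp A eᵢ≈y (Tower.covered T i))
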